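{- Let $p$ be a prime and $n\ge0$ an integer. Then $$\int_{\mathbb{Z}_p}\binom{x+n}{n}\,d\mu_1(x)=\sum_{k=0}^{n}\frac{(-1)^k}{k+1}\sum_{j=0}^{k}(-1)^j\binom{k}{j}\binom{k-j+n}{n}$$ and $$\int_{\mathbb{Z}_p}\binom{x+n}{n}\,d\mu_1(x)=\sum_{k=0}^{n}B_k\sum_{j=0}^{n}\binom{n}{j}\frac{S_1(j,k)}{j!}.$$
   Context: The Volkenborn integral of a polynomial function $f:\mathbb{Z}_p\to\mathbb{Q}_p$ is $\int_{\mathbb{Z}_p}f(x)\,d\mu_1(x)=\lim_{N\to\infty}p^{ -N}\sum_{x=0}^{p^N-1}f(x)$. $\binom{y}{n}=\frac{y(y-1)\cdots(y-n+1)}{n!}$. The (signed) Stirling numbers of the first kind $S_1(j,k)$ are defined by $x(x-1)\cdots(x-j+1)=\sum_{k=0}^jS_1(j,k)x^k$ (and $S_1(j,k)=0$ for $k>j$). The Bernoulli numbers $B_n$ are defined by $\frac{t}{e^t-1}=\sum_{n\ge0}B_n\frac{t^n}{n!}$. -}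

module Defs where

open import Data.Nat as ℕ using (ℕ; zero; suc; _≤_; _^_)
open import Data.Nat.Properties using (_!≢0; m^n≢0)
open import Data.Nat.Combinatorics using (_C_)
open import Data.Nat.Primality using (Prime; prime⇒nonZero)
open import Data.Nat.Divisibility using (_∣_)
open import Data.Integer as ℤ using (ℤ; +_)
open import Data.Rational as ℚ using (ℚ; 0ℚ; 1ℚ; _+_; _*_; _-_; -_; _/_; ↥_)
open import Data.List using (List; []; _∷_; _++_; map; zipWith; [_])
open import Data.Product using (∃)

ℕ→ℚ : ℕ → ℚ
ℕ→ℚ n = (+ n) / 1

ℤ→ℚ : ℤ → ℚ
ℤ→ℚ z = z / 1

inv! : ℕ → ℚ
inv! n = (+ 1) / (n ℕ.!)
  where instance _ = n !≢0

Σ< : ℕ → (ℕ → ℚ) → ℚ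
Σ< zero    f = 0ℚ
Σ< (suc n) f = Σ< n f + f n

Σ₀ : ℕ → (ℕ → ℚ) → ℚ
Σ₀ n f = Σ< (suc n) f

sgn : ℕ → ℚ
sgn zero    = 1ℚ
sgn (suc k) = - sgn k

nthℚ : List ℚ → ℕ → ℚ
nthℚ []       _       = 0ℚ
nthℚ (x ∷ _)  zero    = x
nthℚ (_ ∷ xs) (suc i) = nthℚ xs i

nthℤ : List ℤ → ℕ → ℤ
nthℤ []       _       = + 0
nthℤ (x ∷ _)  zero    = x
nthℤ (_ ∷ xs) (suc i) = nthℤ xs i

-- Stirling numbers of the first kind (signed), via the coefficient
-- list (constant term first) of the falling factorial x(x-1)...(x-j+1).

-- multiply a coefficient list by (x - c)
mulLin : ℕ → List ℤ → List ℤ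
mulLin c p = zipWith ℤ._-_ (+ 0 ∷ p) (map (λ a → (+ c) ℤ.* a) p ++ [ + 0 ])

fallingCoeffs : ℕ → List ℤ
fallingCoeffs zero    = [ + 1 ]
fallingCoeffs (suc j) = mulLin j (fallingCoeffs j)

S₁ : ℕ → ℕ → ℤ
S₁ j k = nthℤ (fallingCoeffs j) k

-- Bernoulli numbers from t/(e^t-1) = Σ B_n t^n/n!, i.e. by comparing
-- coefficients of t^(n+1) in  t = (e^t - 1) · Σ B_j t^j/j! :
--   Σ_{j=0}^{n} B_j /(j! (n+1-j)!) = [n = 0].

δ₀ : ℕ → ℚ
δ₀ zero    = 1ℚ
δ₀ (suc _) = 0ℚ

nextB : ℕ → List ℚ → ℚ
nextB n bs = ℕ→ℚ (n ℕ.!) * (δ₀ n - Σ< n (λ j → nthℚ bs j * inv! j * inv! (suc n ℕ.∸ j)))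

bernList : ℕ → List ℚ
bernList zero    = []
bernList (suc n) = bernList n ++ [ nextB n (bernList n) ]

bernoulli : ℕ → ℚ
bernoulli n = nthℚ (bernList (suc n)) n

-- p-adic convergence of a sequence of rationals:
-- v_p(q) ≥ e (for e ≥ 0) iff p^e divides the numerator of q in lowest terms.
_∣ℚ_ : ℕ → ℚ → Set
m ∣ℚ q = m ∣ ℤ.∣ ↥ q ∣

PadicLim : ℕ → (ℕ → ℚ) → ℚ → Set
PadicLim p a L = ∀ e → ∃ λ N₀ → ∀ N → N₀ ≤ N → (p ^ e) ∣ℚ (a N - L)

volkenbornPartial : (p : ℕ) → Prime p → (ℕ → ℚ) → ℕ → ℚ
volkenbornPartial p pp f N = Σ< (p ^ N) f * ((+ 1) / (p ^ N))
  where instance _ = prime⇒nonZero pp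
                 _ = m^n≢0 p N

VolkenbornIntegral : (p : ℕ) → Prime p → (ℕ → ℚ) → ℚ → Set
VolkenbornIntegral p pp f L = PadicLim p (volkenbornPartial p pp f) L

recipSuc : ℕ → ℚ
recipSuc k = (+ 1) / (suc k)

-- All three quantities equal 1 / (n + 1).
--
-- Integral: by the hockey-stick identity the Riemann sum over 0 ≤ x < M is
-- (M + n choose n) / (n + 1), and n! (M + n choose n) = (M + 1)⋯(M + n) ≡ n! (mod M).
-- Hence for M = p^N the N-th Riemann sum differs from 1 / (n + 1) by p^N times a
-- rational whose denominator divides (n + 1)!, which tends to 0 p-adically.
--
-- First formula: the inner sum is the k-th forward difference of y ↦ (y + n choose n)
-- at 0, i.e. (n choose k), and Σ (-1)^k (n choose k) / (k + 1) = 1 / (n + 1).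
--
-- Second formula: let ∫ g := Σ gₖ Bₖ for a polynomial g = Σ gₖ xᵏ. The Bernoulli
-- recurrence says ∫ g (x + 1) - ∫ g (x) = g′(0). Applied to (x)_{j+1}, whose translate is
-- (x + 1) (x)_j, this gives Σₖ S₁(j, k) Bₖ = ∫ (x)_j = (-1)^j j! / (j + 1), and the
-- sum over j collapses to the first alternating sum again.

module Submission where

open import Defs

module Casts where
  open import Data.Nat as ℕ using (ℕ; suc)
  import Data.Nat.Properties as ℕ
  open import Data.Integer as ℤ using (ℤ; +_)
  import Data.Integer.Properties as ℤ
  open import Data.Rational as ℚ using (ℚ; 1ℚ; _+_; _*_; -_; _/_; ↥_; ↧_; toℚᵘ)
  open import Data.Rational.Properties
  open import Data.Rational.Unnormalised as ℚᵘ using (mkℚᵘ; *≡*)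
  import Data.Rational.Unnormalised.Properties as ℚᵘ
  open import Relation.Binary.PropositionalEquality
  open import Data.Integer.Solver using (module +-*-Solver)
  open +-*-Solver

  toℚᵘ-/ : ∀ z d → toℚᵘ (z / suc d) ℚᵘ.≃ mkℚᵘ z d
  toℚᵘ-/ z d = toℚᵘ-fromℚᵘ (mkℚᵘ z d)

  ℤ→ℚ-homo-+ : ∀ a b → ℤ→ℚ (a ℤ.+ b) ≡ ℤ→ℚ a + ℤ→ℚ b
  ℤ→ℚ-homo-+ a b = toℚᵘ-injective (begin-equality
    toℚᵘ (ℤ→ℚ (a ℤ.+ b))             ≃⟨ toℚᵘ-/ (a ℤ.+ b) 0 ⟩
    mkℚᵘ (a ℤ.+ b) 0
      ≃⟨ *≡* (solve 2 (λ a b → (a :+ b) :* con (+ 1) := (a :* con (+ 1) :+ b :* con (+ 1)) :* con (+ 1)) refl a b) ⟩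
    mkℚᵘ a 0 ℚᵘ.+ mkℚᵘ b 0           ≃⟨ ℚᵘ.+-cong (toℚᵘ-/ a 0) (toℚᵘ-/ b 0) ⟨
    toℚᵘ (ℤ→ℚ a) ℚᵘ.+ toℚᵘ (ℤ→ℚ b)   ≃⟨ toℚᵘ-homo-+ (ℤ→ℚ a) (ℤ→ℚ b) ⟨
    toℚᵘ (ℤ→ℚ a + ℤ→ℚ b)             ∎)
    where open ℚᵘ.≤-Reasoning

  ℤ→ℚ-homo-* : ∀ a b → ℤ→ℚ (a ℤ.* b) ≡ ℤ→ℚ a * ℤ→ℚ b
  ℤ→ℚ-homo-* a b = toℚᵘ-injective (begin-equality
    toℚᵘ (ℤ→ℚ (a ℤ.* b))             ≃⟨ toℚᵘ-/ (a ℤ.* b) 0 ⟩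
    mkℚᵘ a 0 ℚᵘ.* mkℚᵘ b 0           ≃⟨ ℚᵘ.*-cong (toℚᵘ-/ a 0) (toℚᵘ-/ b 0) ⟨
    toℚᵘ (ℤ→ℚ a) ℚᵘ.* toℚᵘ (ℤ→ℚ b)   ≃⟨ toℚᵘ-homo-* (ℤ→ℚ a) (ℤ→ℚ b) ⟨
    toℚᵘ (ℤ→ℚ a * ℤ→ℚ b)             ∎)
    where open ℚᵘ.≤-Reasoning

  ℤ→ℚ-homo‿- : ∀ a → ℤ→ℚ (ℤ.- a) ≡ - ℤ→ℚ a
  ℤ→ℚ-homo‿- a = toℚᵘ-injective (begin-equality
    toℚᵘ (ℤ→ℚ (ℤ.- a))    ≃⟨ toℚᵘ-/ (ℤ.- a) 0 ⟩
    ℚᵘ.- mkℚᵘ a 0         ≃⟨ ℚᵘ.-‿cong (toℚᵘ-/ a 0) ⟨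
    ℚᵘ.- toℚᵘ (ℤ→ℚ a)     ≃⟨ toℚᵘ-homo‿- (ℤ→ℚ a) ⟨
    toℚᵘ (- ℤ→ℚ a)        ∎)
    where open ℚᵘ.≤-Reasoning

  ℕ→ℚ-homo-+ : ∀ m n → ℕ→ℚ (m ℕ.+ n) ≡ ℕ→ℚ m + ℕ→ℚ n
  ℕ→ℚ-homo-+ m n = ℤ→ℚ-homo-+ (+ m) (+ n)

  ℕ→ℚ-homo-* : ∀ m n → ℕ→ℚ (m ℕ.* n) ≡ ℕ→ℚ m * ℕ→ℚ n
  ℕ→ℚ-homo-* m n = trans (cong ℤ→ℚ (ℤ.pos-* m n)) (ℤ→ℚ-homo-* (+ m) (+ n))

  1/n*n≡1 : ∀ n .{{_ : ℕ.NonZero n}} → ((+ 1) / n) * ℕ→ℚ n ≡ 1ℚ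
  1/n*n≡1 (suc n) = toℚᵘ-injective (begin-equality
    toℚᵘ ((+ 1) / suc n * ℕ→ℚ (suc n))           ≃⟨ toℚᵘ-homo-* ((+ 1) / suc n) (ℕ→ℚ (suc n)) ⟩
    toℚᵘ ((+ 1) / suc n) ℚᵘ.* toℚᵘ (ℕ→ℚ (suc n)) ≃⟨ ℚᵘ.*-cong (toℚᵘ-/ (+ 1) n) (toℚᵘ-/ (+ suc n) 0) ⟩
    mkℚᵘ (+ 1) n ℚᵘ.* mkℚᵘ (+ suc n) 0           ≃⟨ *≡* (trans (ℤ.*-identityʳ _) (trans (ℤ.*-identityˡ _)
                                                      (sym (trans (ℤ.*-identityˡ _) (cong +_ (ℕ.*-identityʳ (suc n))))))) ⟩
    toℚᵘ 1ℚ                                       ∎)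
    where open ℚᵘ.≤-Reasoning

  [1+n]*q≡r⇒q≡r/[1+n] : ∀ n {q r} → ℕ→ℚ (suc n) * q ≡ r → q ≡ r * recipSuc n
  [1+n]*q≡r⇒q≡r/[1+n] n {q} {r} eq = begin
    q                               ≡⟨ sym (*-identityˡ q) ⟩
    1ℚ * q                          ≡⟨ cong (_* q) (sym (1/n*n≡1 (suc n))) ⟩
    recipSuc n * ℕ→ℚ (suc n) * q    ≡⟨ *-assoc (recipSuc n) _ q ⟩
    recipSuc n * (ℕ→ℚ (suc n) * q)  ≡⟨ cong (recipSuc n *_) eq ⟩
    recipSuc n * r                  ≡⟨ *-comm (recipSuc n) r ⟩
    r * recipSuc n                  ∎
    where open ≡-Reasoning

  q*n≡z⇒↥q*n≡z*↧q : ∀ q n z → q * ℕ→ℚ n ≡ ℤ→ℚ z → ↥ q ℤ.* + n ≡ z ℤ.* ↧ q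
  q*n≡z⇒↥q*n≡z*↧q q@(ℚ.mkℚ _ d-1 _) n z eq with (begin-equality
    mkℚᵘ (↥ q) d-1 ℚᵘ.* mkℚᵘ (+ n) 0   ≃⟨ ℚᵘ.*-cong (ℚᵘ.≃-refl {toℚᵘ q}) (toℚᵘ-/ (+ n) 0) ⟨
    toℚᵘ q ℚᵘ.* toℚᵘ (ℕ→ℚ n)          ≃⟨ toℚᵘ-homo-* q (ℕ→ℚ n) ⟨
    toℚᵘ (q * ℕ→ℚ n)                  ≃⟨ toℚᵘ-cong eq ⟩
    toℚᵘ (ℤ→ℚ z)                      ≃⟨ toℚᵘ-/ z 0 ⟩
    mkℚᵘ z 0                          ∎)
    where open ℚᵘ.≤-Reasoning
  ... | *≡* e = trans (sym (ℤ.*-identityʳ _)) (trans e (cong (λ m → z ℤ.* + m) (ℕ.*-identityʳ (suc d-1))))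

module FiniteSums where
  open import Data.Nat as ℕ using (ℕ; zero; suc; _≤_; _<_)
  import Data.Nat.Properties as ℕ
  open import Data.Rational using (ℚ; 0ℚ; _+_; _*_; _-_; -_)
  open import Data.Rational.Properties
  open import Relation.Binary.PropositionalEquality
  open import Data.Rational.Solver
  open +-*-Solver

  Σ<-cong : ∀ m {f g : ℕ → ℚ} → (∀ i → i < m → f i ≡ g i) → Σ< m f ≡ Σ< m g
  Σ<-cong zero    f≡g = refl
  Σ<-cong (suc m) f≡g = cong₂ _+_ (Σ<-cong m (λ i i<m → f≡g i (ℕ.m<n⇒m<1+n i<m))) (f≡g m (ℕ.n<1+n m))

  Σ<-zero : ∀ m (f : ℕ → ℚ) → (∀ i → i < m → f i ≡ 0ℚ) → Σ< m f ≡ 0ℚ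
  Σ<-zero zero    f f≡0 = refl
  Σ<-zero (suc m) f f≡0 = trans
    (cong₂ _+_ (Σ<-zero m f (λ i i<m → f≡0 i (ℕ.m<n⇒m<1+n i<m))) (f≡0 m (ℕ.n<1+n m)))
    (+-identityʳ 0ℚ)

  Σ<-distrib-+ : ∀ m (f g : ℕ → ℚ) → Σ< m (λ i → f i + g i) ≡ Σ< m f + Σ< m g
  Σ<-distrib-+ zero    f g = refl
  Σ<-distrib-+ (suc m) f g = trans (cong (_+ (f m + g m)) (Σ<-distrib-+ m f g))
    (solve 4 (λ a b c d → (a :+ b) :+ (c :+ d) := (a :+ c) :+ (b :+ d)) refl (Σ< m f) (Σ< m g) (f m) (g m))

  *-distribˡ-Σ< : ∀ m c (f : ℕ → ℚ) → c * Σ< m f ≡ Σ< m (λ i → c * f i)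
  *-distribˡ-Σ< zero    c f = *-zeroʳ c
  *-distribˡ-Σ< (suc m) c f = trans (*-distribˡ-+ c (Σ< m f) (f m)) (cong (_+ c * f m) (*-distribˡ-Σ< m c f))

  *-distribʳ-Σ< : ∀ m c (f : ℕ → ℚ) → Σ< m f * c ≡ Σ< m (λ i → f i * c)
  *-distribʳ-Σ< m c f = trans (*-comm (Σ< m f) c) (trans (*-distribˡ-Σ< m c f) (Σ<-cong m (λ i _ → *-comm c (f i))))

  neg-distrib-Σ< : ∀ m (f : ℕ → ℚ) → - Σ< m f ≡ Σ< m (λ i → - f i)
  neg-distrib-Σ< zero    f = refl
  neg-distrib-Σ< (suc m) f = trans (neg-distrib-+ (Σ< m f) (f m)) (cong (_+ - f m) (neg-distrib-Σ< m f))

  Σ<-linear : ∀ m (f g : ℕ → ℚ) c → Σ< m (λ i → f i - c * g i) ≡ Σ< m f - c * Σ< m g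
  Σ<-linear m f g c = trans (Σ<-distrib-+ m f _)
    (cong (Σ< m f +_) (sym (trans (cong -_ (*-distribˡ-Σ< m c g)) (neg-distrib-Σ< m _))))

  Σ<-suc-head : ∀ m (f : ℕ → ℚ) → Σ< (suc m) f ≡ f 0 + Σ< m (λ i → f (suc i))
  Σ<-suc-head zero    f = trans (+-identityˡ (f 0)) (sym (+-identityʳ (f 0)))
  Σ<-suc-head (suc m) f = trans (cong (_+ f (suc m)) (Σ<-suc-head m f)) (+-assoc (f 0) _ (f (suc m)))

  Σ<-vanishing-tail : ∀ {a} b (f : ℕ → ℚ) → a ≤ b → (∀ k → a ≤ k → f k ≡ 0ℚ) → Σ< b f ≡ Σ< a f
  Σ<-vanishing-tail {a} b f a≤b f≡0 = go (ℕ.≤⇒≤′ a≤b)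
    where
    go : ∀ {b} → a ℕ.≤′ b → Σ< b f ≡ Σ< a f
    go ℕ.≤′-refl            = refl
    go (ℕ.≤′-step {b} a≤′b) = trans (cong₂ _+_ (go a≤′b) (f≡0 b (ℕ.≤′⇒≤ a≤′b))) (+-identityʳ _)

  Σ<-comm : ∀ a b (f : ℕ → ℕ → ℚ) → Σ< a (λ i → Σ< b (f i)) ≡ Σ< b (λ j → Σ< a (λ i → f i j))
  Σ<-comm zero    b f = sym (Σ<-zero b _ (λ _ _ → refl))
  Σ<-comm (suc a) b f = trans (cong (_+ Σ< b (f a)) (Σ<-comm a b f)) (sym (Σ<-distrib-+ b _ _))

module Binomial where
  open import Data.Nat using (zero; suc; _+_; _*_; _∸_; _≤_; _!)
  open import Data.Nat.Properties
  open import Data.Nat.Combinatorics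
  open import Data.Nat.DivMod using (m/n*n≡m)
  open import Data.Product using (∃; _,_)
  open import Relation.Binary.PropositionalEquality
  open import Data.Nat.Solver using (module +-*-Solver)
  open +-*-Solver

  [1+k]*[1+n]C[1+k]≡[1+n]*nCk : ∀ n k → suc k * (suc n C suc k) ≡ suc n * (n C k)
  [1+k]*[1+n]C[1+k]≡[1+n]*nCk zero    zero    = refl
  [1+k]*[1+n]C[1+k]≡[1+n]*nCk zero    (suc k) = *-zeroʳ (suc (suc k))
  [1+k]*[1+n]C[1+k]≡[1+n]*nCk (suc n) zero    = trans (*-identityˡ _) (trans (nC1≡n (suc (suc n))) (sym (*-identityʳ _)))
  [1+k]*[1+n]C[1+k]≡[1+n]*nCk (suc n) (suc k) = begin
    suc (suc k) * (suc (suc n) C suc (suc k))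
      ≡⟨ cong (suc (suc k) *_) (sym (nCk+nC[k+1]≡[n+1]C[k+1] (suc n) (suc k))) ⟩
    suc (suc k) * (a + b)
      ≡⟨ solve 3 (λ k a b → (con 2 :+ k) :* (a :+ b) := a :+ ((con 1 :+ k) :* a :+ (con 2 :+ k) :* b)) refl k a b ⟩
    a + (suc k * a + suc (suc k) * b)
      ≡⟨ cong (a +_) (cong₂ _+_ ([1+k]*[1+n]C[1+k]≡[1+n]*nCk n k) ([1+k]*[1+n]C[1+k]≡[1+n]*nCk n (suc k))) ⟩
    a + (suc n * (n C k) + suc n * (n C suc k))
      ≡⟨ cong (a +_) (sym (*-distribˡ-+ (suc n) (n C k) (n C suc k))) ⟩
    a + suc n * (n C k + n C suc k)
      ≡⟨ cong (λ c → a + suc n * c) (nCk+nC[k+1]≡[n+1]C[k+1] n k) ⟩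
    suc (suc n) * a
      ∎
    where
    open ≡-Reasoning
    a = suc n C suc k
    b = suc n C suc (suc k)

  [m+n]Cm≡[m+n]Cn : ∀ m n → (m + n) C m ≡ (m + n) C n
  [m+n]Cm≡[m+n]Cn m n = trans (nCk≡nC[n∸k] (m≤m+n m n)) (cong ((m + n) C_) (m+n∸m≡n m n))

  [1+m]*[1+m+n]Cn≡[1+m+n]*[m+n]Cn : ∀ m n → suc m * ((suc m + n) C n) ≡ suc (m + n) * ((m + n) C n)
  [1+m]*[1+m+n]Cn≡[1+m+n]*[m+n]Cn m n = begin
    suc m * ((suc m + n) C n)      ≡⟨ cong (suc m *_) (sym ([m+n]Cm≡[m+n]Cn (suc m) n)) ⟩
    suc m * ((suc m + n) C suc m)  ≡⟨ [1+k]*[1+n]C[1+k]≡[1+n]*nCk (m + n) m ⟩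
    suc (m + n) * ((m + n) C m)    ≡⟨ cong (suc (m + n) *_) ([m+n]Cm≡[m+n]Cn m n) ⟩
    suc (m + n) * ((m + n) C n)    ∎
    where open ≡-Reasoning

  -- n! (M + n choose n) = (M + 1)(M + 2)⋯(M + n).
  n!*[M+n]Cn≡n!-mod-M : ∀ n M → ∃ λ s → n ! * ((M + n) C n) ≡ n ! + M * s
  n!*[M+n]Cn≡n!-mod-M zero    M = 0 , cong suc (sym (*-zeroʳ M))
  n!*[M+n]Cn≡n!-mod-M (suc n) M with n!*[M+n]Cn≡n!-mod-M n M
  ... | s , eq = n ! + s * suc (M + n) , (begin
    suc n ! * ((M + suc n) C suc n)
      ≡⟨ cong (λ m → suc n ! * (m C suc n)) (+-suc M n) ⟩
    (suc n * n !) * (suc (M + n) C suc n)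
      ≡⟨ solve 3 (λ a b c → (a :* b) :* c := b :* (a :* c)) refl (suc n) (n !) (suc (M + n) C suc n) ⟩
    n ! * (suc n * (suc (M + n) C suc n))
      ≡⟨ cong (n ! *_) ([1+k]*[1+n]C[1+k]≡[1+n]*nCk (M + n) n) ⟩
    n ! * (suc (M + n) * ((M + n) C n))
      ≡⟨ solve 3 (λ a b c → a :* (b :* c) := b :* (a :* c)) refl (n !) (suc (M + n)) ((M + n) C n) ⟩
    suc (M + n) * (n ! * ((M + n) C n))
      ≡⟨ cong (suc (M + n) *_) eq ⟩
    suc (M + n) * (n ! + M * s)
      ≡⟨ solve 4 (λ M n f s → (con 1 :+ (M :+ n)) :* (f :+ M :* s) := (con 1 :+ n) :* f :+ M :* (f :+ s :* (con 1 :+ (M :+ n))))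
                 refl M n (n !) s ⟩
    suc n * n ! + M * (n ! + s * suc (M + n))
      ∎)
    where open ≡-Reasoning

  nCk*[k!*[n∸k]!]≡n! : ∀ n k → k ≤ n → (n C k) * (k ! * (n ∸ k) !) ≡ n !
  nCk*[k!*[n∸k]!]≡n! n k k≤n = trans (cong (_* (k ! * (n ∸ k) !)) (nCk≡n!/k![n-k]! k≤n))
    (m/n*n≡m {{k !* (n ∸ k) !≢0}} (k![n∸k]!∣n! k≤n))

module Differences where
  open Casts
  open FiniteSums
  open Binomial
  open import Data.Nat as ℕ using (ℕ; zero; suc; _∸_; _≤_; _<_)
  import Data.Nat.Properties as ℕ
  open import Data.Nat.Combinatorics using (_C_; nCk≡nC[n∸k]; nCk+nC[k+1]≡[n+1]C[k+1]; k>n⇒nCk≡0)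
  open import Data.Rational using (ℚ; 0ℚ; 1ℚ; _+_; _*_; _-_; -_)
  open import Data.Rational.Properties
  open import Relation.Binary.PropositionalEquality
  open import Data.Rational.Solver
  open +-*-Solver

  Δ : (ℕ → ℚ) → ℕ → ℕ → ℚ
  Δ h k a = Σ₀ k (λ j → sgn j * ℕ→ℚ (k C j) * h (a ℕ.+ (k ∸ j)))

  -- Pascal's rule splits Δ h (1 + k) a into a sum of shifted terms and a sum of
  -- negated unshifted ones; the two boundary terms match up or vanish.
  Δ-suc : ∀ h k a → Δ h (suc k) a ≡ Δ h k (suc a) - Δ h k a
  Δ-suc h k a = begin
    Δ h (suc k) a
      ≡⟨ Σ<-suc-head (suc k) term ⟩
    term 0 + Σ< (suc k) (λ i → term (suc i))
      ≡⟨ cong (term 0 +_) (trans (Σ<-cong (suc k) (λ i _ → pascal i)) (Σ<-distrib-+ (suc k) _ _)) ⟩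
    term 0 + (Σ< (suc k) (λ i → - old i) + Σ< (suc k) new)
      ≡⟨ cong₂ (λ u v → term 0 + (u + v)) (sym (neg-distrib-Σ< (suc k) old)) (cong₂ _+_ (Σ<-cong k new≡) new-top) ⟩
    term 0 + (- Δ h k a + (Σ< k (λ i → shifted (suc i)) + 0ℚ))
      ≡⟨ cong (_+ (- Δ h k a + (Σ< k (λ i → shifted (suc i)) + 0ℚ))) head ⟩
    shifted 0 + (- Δ h k a + (Σ< k (λ i → shifted (suc i)) + 0ℚ))
      ≡⟨ solve 3 (λ g d s → g :+ (:- d :+ (s :+ con 0ℚ)) := (g :+ s) :- d) refl (shifted 0) (Δ h k a) _ ⟩
    (shifted 0 + Σ< k (λ i → shifted (suc i))) - Δ h k a
      ≡⟨ cong (_- Δ h k a) (sym (Σ<-suc-head k shifted)) ⟩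
    Δ h k (suc a) - Δ h k a
      ∎
    where
    open ≡-Reasoning
    term shifted old new : ℕ → ℚ
    term j    = sgn j * ℕ→ℚ (suc k C j) * h (a ℕ.+ (suc k ∸ j))
    shifted j = sgn j * ℕ→ℚ (k C j) * h (suc a ℕ.+ (k ∸ j))
    old i     = sgn i * ℕ→ℚ (k C i) * h (a ℕ.+ (k ∸ i))
    new i     = - (sgn i * ℕ→ℚ (k C suc i) * h (a ℕ.+ (k ∸ i)))
    head : term 0 ≡ shifted 0
    head = cong (λ b → 1ℚ * 1ℚ * h b) (ℕ.+-suc a k)
    pascal : ∀ i → term (suc i) ≡ - old i + new i
    pascal i = trans (cong (λ c → - sgn i * ℕ→ℚ c * h (a ℕ.+ (k ∸ i))) (sym (nCk+nC[k+1]≡[n+1]C[k+1] k i)))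
      (trans (cong (λ c → - sgn i * c * h (a ℕ.+ (k ∸ i))) (ℕ→ℚ-homo-+ (k C i) (k C suc i)))
        (solve 4 (λ s x y z → (:- s) :* (x :+ y) :* z := :- (s :* x :* z) :+ :- (s :* y :* z)) refl (sgn i) _ _ _))
    new≡ : ∀ i → i < k → new i ≡ shifted (suc i)
    new≡ i i<k = trans (cong (λ b → - (sgn i * ℕ→ℚ (k C suc i) * h b)) a+[k∸i]≡1+a+[k∸1+i])
      (solve 3 (λ s x z → :- (s :* x :* z) := (:- s) :* x :* z) refl (sgn i) _ _)
      where
      a+[k∸i]≡1+a+[k∸1+i] : a ℕ.+ (k ∸ i) ≡ suc a ℕ.+ (k ∸ suc i)
      a+[k∸i]≡1+a+[k∸1+i] = trans (cong (a ℕ.+_) (ℕ.+-∸-assoc 1 i<k)) (ℕ.+-suc a (k ∸ suc i))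
    new-top : new k ≡ 0ℚ
    new-top = trans (cong (λ c → - (sgn k * ℕ→ℚ c * h (a ℕ.+ (k ∸ k)))) (k>n⇒nCk≡0 (ℕ.n<1+n k)))
      (solve 2 (λ s z → :- (s :* con 0ℚ :* z) := con 0ℚ) refl (sgn k) _)

  Δ-const-suc : ∀ c k a → Δ (λ _ → c) (suc k) a ≡ 0ℚ
  Δ-const-suc c k a = trans (Δ-suc (λ _ → c) k a) (+-inverseʳ (Δ (λ _ → c) k a))

  Δ-[y+n]Cn : ∀ n k a → k ≤ n → Δ (λ y → ℕ→ℚ ((y ℕ.+ n) C n)) k a ≡ ℕ→ℚ ((a ℕ.+ n) C (n ∸ k))
  Δ-[y+n]Cn n zero    a _   = trans (+-identityˡ _) (trans (*-identityˡ _)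
    (cong (λ b → ℕ→ℚ ((b ℕ.+ n) C n)) (ℕ.+-identityʳ a)))
  Δ-[y+n]Cn n (suc k) a k<n = begin
    Δ h (suc k) a
      ≡⟨ Δ-suc h k a ⟩
    Δ h k (suc a) - Δ h k a
      ≡⟨ cong₂ _-_ (Δ-[y+n]Cn n k (suc a) k≤n) (Δ-[y+n]Cn n k a k≤n) ⟩
    ℕ→ℚ (suc m C (n ∸ k)) - ℕ→ℚ (m C (n ∸ k))
      ≡⟨ cong (λ r → ℕ→ℚ (suc m C r) - ℕ→ℚ (m C r)) (ℕ.+-∸-assoc 1 k<n) ⟩
    ℕ→ℚ (suc m C suc r) - ℕ→ℚ (m C suc r)
      ≡⟨ cong (_- ℕ→ℚ (m C suc r)) (trans (cong ℕ→ℚ (sym (nCk+nC[k+1]≡[n+1]C[k+1] m r))) (ℕ→ℚ-homo-+ (m C r) (m C suc r))) ⟩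
    ℕ→ℚ (m C r) + ℕ→ℚ (m C suc r) - ℕ→ℚ (m C suc r)
      ≡⟨ solve 2 (λ x y → x :+ y :- y := x) refl (ℕ→ℚ (m C r)) (ℕ→ℚ (m C suc r)) ⟩
    ℕ→ℚ (m C r)
      ∎
    where
    open ≡-Reasoning
    h = λ y → ℕ→ℚ ((y ℕ.+ n) C n)
    k≤n : k ≤ n
    k≤n = ℕ.<⇒≤ k<n
    m = a ℕ.+ n
    r = n ∸ suc k

  Σ₀-sgn*[1+n]C[1+k]≡1 : ∀ n → Σ₀ n (λ k → sgn k * ℕ→ℚ (suc n C suc k)) ≡ 1ℚ
  Σ₀-sgn*[1+n]C[1+k]≡1 n = begin
    S                            ≡⟨ solve 1 (λ s → s := con 1ℚ :- (con 1ℚ :+ :- s)) refl S ⟩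
    1ℚ - (1ℚ + - S)              ≡⟨ cong (λ x → 1ℚ - x) (sym Δ1≡1-S) ⟩
    1ℚ - Δ (λ _ → 1ℚ) (suc n) 0  ≡⟨ cong (λ x → 1ℚ - x) (Δ-const-suc 1ℚ n 0) ⟩
    1ℚ - 0ℚ                      ≡⟨ +-identityʳ 1ℚ ⟩
    1ℚ                           ∎
    where
    open ≡-Reasoning
    S = Σ₀ n (λ k → sgn k * ℕ→ℚ (suc n C suc k))
    Δ1≡1-S : Δ (λ _ → 1ℚ) (suc n) 0 ≡ 1ℚ + - S
    Δ1≡1-S = trans (Σ<-suc-head (suc n) _) (cong (1ℚ +_) (trans
      (Σ<-cong (suc n) (λ k _ → solve 2 (λ s c → (:- s) :* c :* con 1ℚ := :- (s :* c)) refl (sgn k) _))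
      (sym (neg-distrib-Σ< (suc n) _))))

  Σ₀-sgn/[1+k]*nCk≡1/[1+n] : ∀ n → Σ₀ n (λ k → sgn k * recipSuc k * ℕ→ℚ (n C k)) ≡ recipSuc n
  Σ₀-sgn/[1+k]*nCk≡1/[1+n] n = trans ([1+n]*q≡r⇒q≡r/[1+n] n [1+n]*Σ≡1) (*-identityˡ (recipSuc n))
    where
    open ≡-Reasoning
    absorb : ∀ k → ℕ→ℚ (suc n) * (sgn k * recipSuc k * ℕ→ℚ (n C k)) ≡ sgn k * ℕ→ℚ (suc n C suc k)
    absorb k = begin
      N * (sgn k * recipSuc k * c)   ≡⟨ solve 4 (λ a s r c → a :* (s :* r :* c) := s :* r :* (a :* c)) refl N (sgn k) (recipSuc k) c ⟩
      sgn k * recipSuc k * (N * c)   ≡⟨ cong (sgn k * recipSuc k *_) N*c≡K*c′ ⟩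
      sgn k * recipSuc k * (K * c′)  ≡⟨ solve 4 (λ s r a c → s :* r :* (a :* c) := s :* (r :* a) :* c) refl (sgn k) (recipSuc k) K c′ ⟩
      sgn k * (recipSuc k * K) * c′  ≡⟨ cong (λ x → sgn k * x * c′) (1/n*n≡1 (suc k)) ⟩
      sgn k * 1ℚ * c′                ≡⟨ cong (_* c′) (*-identityʳ (sgn k)) ⟩
      sgn k * c′                     ∎
      where
      N = ℕ→ℚ (suc n)
      K = ℕ→ℚ (suc k)
      c = ℕ→ℚ (n C k)
      c′ = ℕ→ℚ (suc n C suc k)
      N*c≡K*c′ : N * c ≡ K * c′
      N*c≡K*c′ = trans (sym (ℕ→ℚ-homo-* (suc n) (n C k)))
        (trans (cong ℕ→ℚ (sym ([1+k]*[1+n]C[1+k]≡[1+n]*nCk n k))) (ℕ→ℚ-homo-* (suc k) (suc n C suc k)))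
    [1+n]*Σ≡1 : ℕ→ℚ (suc n) * Σ₀ n (λ k → sgn k * recipSuc k * ℕ→ℚ (n C k)) ≡ 1ℚ
    [1+n]*Σ≡1 = trans (*-distribˡ-Σ< (suc n) (ℕ→ℚ (suc n)) _)
      (trans (Σ<-cong (suc n) (λ k _ → absorb k)) (Σ₀-sgn*[1+n]C[1+k]≡1 n))

  Σ₀-sgn/[1+k]*Δᵏ[y+n]Cn≡1/[1+n] : ∀ n →
    Σ₀ n (λ k → sgn k * recipSuc k * Σ₀ k (λ j → sgn j * ℕ→ℚ (k C j) * ℕ→ℚ ((k ∸ j ℕ.+ n) C n))) ≡ recipSuc n
  Σ₀-sgn/[1+k]*Δᵏ[y+n]Cn≡1/[1+n] n = trans (Σ<-cong (suc n) (λ k k<1+n → cong (sgn k * recipSuc k *_) (Δᵏ≡nCk k k<1+n)))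
    (Σ₀-sgn/[1+k]*nCk≡1/[1+n] n)
    where
    Δᵏ≡nCk : ∀ k → k < suc n → Δ (λ y → ℕ→ℚ ((y ℕ.+ n) C n)) k 0 ≡ ℕ→ℚ (n C k)
    Δᵏ≡nCk k k<1+n = trans (Δ-[y+n]Cn n k 0 (ℕ.≤-pred k<1+n)) (cong ℕ→ℚ (sym (nCk≡nC[n∸k] (ℕ.≤-pred k<1+n))))

module Bernoulli where
  open Casts
  open FiniteSums
  open Binomial
  open import Data.Nat as ℕ using (ℕ; zero; suc; _∸_; _≤_; _<_; _!)
  import Data.Nat.Properties as ℕ
  open import Data.Nat.Combinatorics using (_C_)
  open import Data.Rational using (ℚ; 1ℚ; _+_; _*_; _-_)
  open import Data.Rational.Properties
  open import Data.List using (List; []; _∷_; _++_; [_]; length)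
  open import Data.List.Properties using (length-++)
  open import Data.Sum using (inj₁; inj₂)
  open import Relation.Binary.PropositionalEquality hiding ([_])
  open import Data.Rational.Solver
  open +-*-Solver

  inv!*!≡1 : ∀ j → inv! j * ℕ→ℚ (j !) ≡ 1ℚ
  inv!*!≡1 j = 1/n*n≡1 (j !) {{j ℕ.!≢0}}

  nCk≡n!*inv!k*inv![n∸k] : ∀ n k → k ≤ n → ℕ→ℚ (n C k) ≡ ℕ→ℚ (n !) * (inv! k * inv! (n ∸ k))
  nCk≡n!*inv!k*inv![n∸k] n k k≤n = begin
    c                              ≡⟨ solve 1 (λ c → c := c :* con 1ℚ :* con 1ℚ) refl c ⟩
    c * 1ℚ * 1ℚ                    ≡⟨ cong₂ (λ u v → c * u * v) (sym (inv!*!≡1 k)) (sym (inv!*!≡1 (n ∸ k))) ⟩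
    c * (i * x) * (i′ * x′)
      ≡⟨ solve 5 (λ c i x i′ x′ → c :* (i :* x) :* (i′ :* x′) := c :* (x :* x′) :* (i :* i′)) refl c i x i′ x′ ⟩
    c * (x * x′) * (i * i′)        ≡⟨ cong (_* (i * i′)) c*x*x′≡n! ⟩
    ℕ→ℚ (n !) * (i * i′)           ∎
    where
    open ≡-Reasoning
    c = ℕ→ℚ (n C k)
    i = inv! k
    i′ = inv! (n ∸ k)
    x = ℕ→ℚ (k !)
    x′ = ℕ→ℚ ((n ∸ k) !)
    c*x*x′≡n! : c * (x * x′) ≡ ℕ→ℚ (n !)
    c*x*x′≡n! = trans (cong (c *_) (sym (ℕ→ℚ-homo-* (k !) _)))
      (trans (sym (ℕ→ℚ-homo-* (n C k) _)) (cong ℕ→ℚ (nCk*[k!*[n∸k]!]≡n! n k k≤n)))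

  nthℚ-++ : ∀ (xs : List ℚ) y {j} → j < length xs → nthℚ (xs ++ [ y ]) j ≡ nthℚ xs j
  nthℚ-++ (x ∷ xs) y {zero}  _   = refl
  nthℚ-++ (x ∷ xs) y {suc j} j<n = nthℚ-++ xs y (ℕ.≤-pred j<n)

  nthℚ-last : ∀ (xs : List ℚ) y → nthℚ (xs ++ [ y ]) (length xs) ≡ y
  nthℚ-last []       y = refl
  nthℚ-last (x ∷ xs) y = nthℚ-last xs y

  length-bernList : ∀ m → length (bernList m) ≡ m
  length-bernList zero    = refl
  length-bernList (suc m) = trans (length-++ (bernList m)) (trans (cong (ℕ._+ 1) (length-bernList m)) (ℕ.+-comm m 1))

  nthℚ-bernList : ∀ m j → j < m → nthℚ (bernList m) j ≡ bernoulli j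
  nthℚ-bernList (suc m) j j<1+m with ℕ.m≤n⇒m<n∨m≡n (ℕ.≤-pred j<1+m)
  ... | inj₁ j<m  = trans (nthℚ-++ (bernList m) _ (subst (j <_) (sym (length-bernList m)) j<m)) (nthℚ-bernList m j j<m)
  ... | inj₂ refl = refl

  bernoulli-rec : ∀ n → bernoulli n ≡ ℕ→ℚ (n !) * (δ₀ n - Σ< n (λ j → bernoulli j * inv! j * inv! (suc n ∸ j)))
  bernoulli-rec n = trans (trans (cong (nthℚ (bernList (suc n))) (sym (length-bernList n))) (nthℚ-last (bernList n) _))
    (cong (λ s → ℕ→ℚ (n !) * (δ₀ n - s))
      (Σ<-cong n (λ j j<n → cong (λ b → b * inv! j * inv! (suc n ∸ j)) (nthℚ-bernList n j j<n))))

  Σ₀-Bj*inv!j*inv![1+n∸j]≡δ₀n : ∀ n → Σ₀ n (λ j → bernoulli j * inv! j * inv! (suc n ∸ j)) ≡ δ₀ n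
  Σ₀-Bj*inv!j*inv![1+n∸j]≡δ₀n n = begin
    S + bernoulli n * inv! n * inv! (suc n ∸ n)
      ≡⟨ cong (λ m → S + bernoulli n * inv! n * inv! m) (ℕ.m+n∸n≡m 1 n) ⟩
    S + bernoulli n * inv! n * 1ℚ
      ≡⟨ cong (λ b → S + b * inv! n * 1ℚ) (bernoulli-rec n) ⟩
    S + ℕ→ℚ (n !) * (δ₀ n - S) * inv! n * 1ℚ
      ≡⟨ solve 4 (λ s f d i → s :+ f :* (d :- s) :* i :* con 1ℚ := s :+ (i :* f) :* (d :- s)) refl S (ℕ→ℚ (n !)) (δ₀ n) (inv! n) ⟩
    S + inv! n * ℕ→ℚ (n !) * (δ₀ n - S)
      ≡⟨ cong (λ x → S + x * (δ₀ n - S)) (inv!*!≡1 n) ⟩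
    S + 1ℚ * (δ₀ n - S)
      ≡⟨ solve 2 (λ s d → s :+ con 1ℚ :* (d :- s) := d) refl S (δ₀ n) ⟩
    δ₀ n
      ∎
    where
    open ≡-Reasoning
    S = Σ< n (λ j → bernoulli j * inv! j * inv! (suc n ∸ j))

  Σ₀-[1+n]Cj*Bj≡δ₀n : ∀ n → Σ₀ n (λ j → ℕ→ℚ (suc n C j) * bernoulli j) ≡ δ₀ n
  Σ₀-[1+n]Cj*Bj≡δ₀n n = begin
    Σ₀ n (λ j → ℕ→ℚ (suc n C j) * bernoulli j)                   ≡⟨ Σ<-cong (suc n) (λ j j<2+n → term j (ℕ.<⇒≤ j<2+n)) ⟩
    Σ₀ n (λ j → F * (bernoulli j * inv! j * inv! (suc n ∸ j)))   ≡⟨ sym (*-distribˡ-Σ< (suc n) F _) ⟩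
    F * Σ₀ n (λ j → bernoulli j * inv! j * inv! (suc n ∸ j))     ≡⟨ cong (F *_) (Σ₀-Bj*inv!j*inv![1+n∸j]≡δ₀n n) ⟩
    F * δ₀ n                                                     ≡⟨ F*δ₀n≡δ₀n n ⟩
    δ₀ n                                                         ∎
    where
    open ≡-Reasoning
    F = ℕ→ℚ (suc n !)
    F*δ₀n≡δ₀n : ∀ n → ℕ→ℚ (suc n !) * δ₀ n ≡ δ₀ n
    F*δ₀n≡δ₀n zero    = refl
    F*δ₀n≡δ₀n (suc n) = *-zeroʳ (ℕ→ℚ (suc (suc n) !))
    term : ∀ j → j ≤ suc n → ℕ→ℚ (suc n C j) * bernoulli j ≡ F * (bernoulli j * inv! j * inv! (suc n ∸ j))
    term j j≤1+n = trans (cong (_* bernoulli j) (nCk≡n!*inv!k*inv![n∸k] (suc n) j j≤1+n))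
      (solve 4 (λ f i i′ b → f :* (i :* i′) :* b := f :* (b :* i :* i′)) refl F (inv! j) (inv! (suc n ∸ j)) (bernoulli j))

module Stirling where
  open Casts
  open import Data.Nat as ℕ using (ℕ; zero; suc; _<_; _!; s≤s)
  import Data.Nat.Properties as ℕ
  open import Data.Integer as ℤ using (+_)
  import Data.Integer.Properties as ℤ
  open import Data.Rational using (ℚ; 0ℚ; _+_; _*_; _-_; -_)
  open import Data.List using ([]; _∷_; _++_; [_]; map; zipWith)
  open import Relation.Binary.PropositionalEquality hiding ([_])
  open import Data.Rational.Solver
  open +-*-Solver

  -- Polynomials are coefficient sequences ℕ → ℚ, constant term first.
  mulX : (ℕ → ℚ) → ℕ → ℚ
  mulX g zero    = 0ℚ
  mulX g (suc k) = g k

  s₁ : ℕ → ℕ → ℚ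
  s₁ j k = ℤ→ℚ (S₁ j k)

  nthℤ-mulLin : ∀ c p k → nthℤ (mulLin c p) k ≡ nthℤ (+ 0 ∷ p) k ℤ.- + c ℤ.* nthℤ p k
  nthℤ-mulLin c = go (+ 0)
    where
    go : ∀ a p k → nthℤ (zipWith ℤ._-_ (a ∷ p) (map (+ c ℤ.*_) p ++ [ + 0 ])) k ≡ nthℤ (a ∷ p) k ℤ.- + c ℤ.* nthℤ p k
    go a []      zero    = cong (λ z → a ℤ.- z) (sym (ℤ.*-zeroʳ (+ c)))
    go a []      (suc k) = cong (λ z → + 0 ℤ.- z) (sym (ℤ.*-zeroʳ (+ c)))
    go a (x ∷ p) zero    = refl
    go a (x ∷ p) (suc k) = go x p k

  S₁-vanish : ∀ j k → j < k → S₁ j k ≡ + 0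
  S₁-vanish zero    (suc k) _         = refl
  S₁-vanish (suc j) (suc k) (s≤s j<k) = trans (nthℤ-mulLin j (fallingCoeffs j) (suc k))
    (trans (cong₂ (λ u v → u ℤ.- + j ℤ.* v) (S₁-vanish j k j<k) (S₁-vanish j (suc k) (ℕ.m<n⇒m<1+n j<k)))
      (cong (λ z → + 0 ℤ.- z) (ℤ.*-zeroʳ (+ j))))

  s₁-vanish : ∀ j k → j < k → s₁ j k ≡ 0ℚ
  s₁-vanish j k j<k = cong ℤ→ℚ (S₁-vanish j k j<k)

  -- (x)_{j+1} = x (x)_j - j (x)_j
  s₁-suc : ∀ j k → s₁ (suc j) k ≡ mulX (s₁ j) k - ℕ→ℚ j * s₁ j k
  s₁-suc j k = begin
    ℤ→ℚ (nthℤ (mulLin j (fallingCoeffs j)) k)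
      ≡⟨ cong ℤ→ℚ (nthℤ-mulLin j (fallingCoeffs j) k) ⟩
    ℤ→ℚ (shifted ℤ.- + j ℤ.* S₁ j k)
      ≡⟨ ℤ→ℚ-homo-+ shifted (ℤ.- (+ j ℤ.* S₁ j k)) ⟩
    ℤ→ℚ shifted + ℤ→ℚ (ℤ.- (+ j ℤ.* S₁ j k))
      ≡⟨ cong₂ _+_ (shifted≡ k) (trans (ℤ→ℚ-homo‿- (+ j ℤ.* S₁ j k)) (cong -_ (ℤ→ℚ-homo-* (+ j) (S₁ j k)))) ⟩
    mulX (s₁ j) k - ℕ→ℚ j * s₁ j k
      ∎
    where
    open ≡-Reasoning
    shifted = nthℤ (+ 0 ∷ fallingCoeffs j) k
    shifted≡ : ∀ k → ℤ→ℚ (nthℤ (+ 0 ∷ fallingCoeffs j) k) ≡ mulX (s₁ j) k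
    shifted≡ zero    = refl
    shifted≡ (suc k) = refl

  s₁-suc-zero : ∀ j → s₁ (suc j) 0 ≡ 0ℚ
  s₁-suc-zero zero    = refl
  s₁-suc-zero (suc j) = trans (s₁-suc (suc j) 0) (trans (cong (λ s → 0ℚ - ℕ→ℚ (suc j) * s) (s₁-suc-zero j))
    (solve 1 (λ x → con 0ℚ :- x :* con 0ℚ := con 0ℚ) refl (ℕ→ℚ (suc j))))

  s₁-suc-one : ∀ j → s₁ (suc j) 1 ≡ sgn j * ℕ→ℚ (j !)
  s₁-suc-one zero    = refl
  s₁-suc-one (suc j) = begin
    s₁ (suc (suc j)) 1                         ≡⟨ s₁-suc (suc j) 1 ⟩
    s₁ (suc j) 0 - ℕ→ℚ (suc j) * s₁ (suc j) 1  ≡⟨ cong₂ (λ u v → u - ℕ→ℚ (suc j) * v) (s₁-suc-zero j) (s₁-suc-one j) ⟩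
    0ℚ - ℕ→ℚ (suc j) * (sgn j * ℕ→ℚ (j !))
      ≡⟨ solve 3 (λ a s f → con 0ℚ :- a :* (s :* f) := (:- s) :* (a :* f)) refl (ℕ→ℚ (suc j)) (sgn j) (ℕ→ℚ (j !)) ⟩
    - sgn j * (ℕ→ℚ (suc j) * ℕ→ℚ (j !))        ≡⟨ cong (- sgn j *_) (sym (ℕ→ℚ-homo-* (suc j) (j !))) ⟩
    sgn (suc j) * ℕ→ℚ (suc j !)                ∎
    where open ≡-Reasoning

module Umbral where
  open Casts
  open FiniteSums
  open Differences using (Σ₀-sgn/[1+k]*nCk≡1/[1+n])
  open Bernoulli
  open Stirling
  open import Data.Nat as ℕ using (ℕ; zero; suc; _≤_; _<_; _!; z≤n; s≤s)
  import Data.Nat.Properties as ℕ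
  open import Data.Nat.Combinatorics using (_C_; nCn≡1; nCk+nC[k+1]≡[n+1]C[k+1]; k>n⇒nCk≡0)
  open import Data.Rational using (ℚ; 0ℚ; 1ℚ; _+_; _*_; _-_)
  open import Data.Rational.Properties
  open import Relation.Binary.PropositionalEquality
  open import Data.Rational.Solver
  open +-*-Solver

  -- The coefficients of g (x + 1), for g of degree < d.
  translate : ℕ → (ℕ → ℚ) → ℕ → ℚ
  translate d g k = Σ< d (λ m → ℕ→ℚ (m C k) * g m)

  -- ∫ g dμ₁ for g of degree < d, computed termwise from ∫ xᵏ dμ₁ = Bₖ.
  umbral : ℕ → (ℕ → ℚ) → ℚ
  umbral d g = Σ< d (λ k → g k * bernoulli k)

  translate-cong : ∀ d {g h} k → (∀ m → g m ≡ h m) → translate d g k ≡ translate d h k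
  translate-cong d k g≡h = Σ<-cong d (λ m _ → cong (ℕ→ℚ (m C k) *_) (g≡h m))

  translate-linear : ∀ d a c b k → translate d (λ m → a m - c * b m) k ≡ translate d a k - c * translate d b k
  translate-linear d a c b k = trans (Σ<-cong d (λ m _ → distrib (ℕ→ℚ (m C k)) (a m) (b m))) (Σ<-linear d _ _ c)
    where
    distrib : ∀ x a b → x * (a - c * b) ≡ x * a - c * (x * b)
    distrib x a b = solve 4 (λ x a c b → x :* (a :- c :* b) := x :* a :- c :* (x :* b)) refl x a c b

  translate-mulX : ∀ d g k → translate (suc d) (mulX g) k ≡ translate d g k + mulX (translate d g) k
  translate-mulX d g zero    = trans (Σ<-suc-head d _)
    (solve 2 (λ a s → a :* con 0ℚ :+ s := s :+ con 0ℚ) refl (ℕ→ℚ (0 C 0)) (translate d g 0))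
  translate-mulX d g (suc k) = begin
    translate (suc d) (mulX g) (suc k)
      ≡⟨ Σ<-suc-head d _ ⟩
    ℕ→ℚ (0 C suc k) * 0ℚ + Σ< d (λ i → ℕ→ℚ (suc i C suc k) * g i)
      ≡⟨ cong₂ _+_ (*-zeroʳ (ℕ→ℚ (0 C suc k))) (Σ<-cong d (λ i _ → pascal i)) ⟩
    0ℚ + Σ< d (λ i → ℕ→ℚ (i C suc k) * g i + ℕ→ℚ (i C k) * g i)
      ≡⟨ +-identityˡ _ ⟩
    Σ< d (λ i → ℕ→ℚ (i C suc k) * g i + ℕ→ℚ (i C k) * g i)
      ≡⟨ Σ<-distrib-+ d _ _ ⟩
    translate d g (suc k) + translate d g k
      ∎
    where
    open ≡-Reasoning
    pascal : ∀ i → ℕ→ℚ (suc i C suc k) * g i ≡ ℕ→ℚ (i C suc k) * g i + ℕ→ℚ (i C k) * g i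
    pascal i = trans (cong (λ c → ℕ→ℚ c * g i) (sym (nCk+nC[k+1]≡[n+1]C[k+1] i k)))
      (trans (cong (_* g i) (ℕ→ℚ-homo-+ (i C k) (i C suc k)))
        (solve 3 (λ a b x → (a :+ b) :* x := b :* x :+ a :* x) refl (ℕ→ℚ (i C k)) (ℕ→ℚ (i C suc k)) (g i)))

  translate-suc-vanish : ∀ d g k → g d ≡ 0ℚ → translate (suc d) g k ≡ translate d g k
  translate-suc-vanish d g k gd≡0 = trans (cong (λ x → translate d g k + ℕ→ℚ (d C k) * x) gd≡0)
    (trans (cong (translate d g k +_) (*-zeroʳ (ℕ→ℚ (d C k)))) (+-identityʳ _))

  umbral-cong : ∀ d {g h} → (∀ m → g m ≡ h m) → umbral d g ≡ umbral d h
  umbral-cong d g≡h = Σ<-cong d (λ m _ → cong (_* bernoulli m) (g≡h m))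

  umbral-+ : ∀ d a b → umbral d (λ m → a m + b m) ≡ umbral d a + umbral d b
  umbral-+ d a b = trans (Σ<-cong d (λ m _ → *-distribʳ-+ (bernoulli m) (a m) (b m))) (Σ<-distrib-+ d _ _)

  umbral-linear : ∀ d a c b → umbral d (λ m → a m - c * b m) ≡ umbral d a - c * umbral d b
  umbral-linear d a c b = trans (Σ<-cong d (λ m _ → distrib (bernoulli m) (a m) (b m))) (Σ<-linear d _ _ c)
    where
    distrib : ∀ x a b → (a - c * b) * x ≡ a * x - c * (b * x)
    distrib x a b = solve 4 (λ x a c b → (a :- c :* b) :* x := a :* x :- c :* (b :* x)) refl x a c b

  -- ∫ (x + 1)ᵐ dμ₁ - ∫ xᵐ dμ₁ = [m = 1] is the Bernoulli recurrence, so the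
  -- integral of g (x + 1) - g (x) picks out the linear coefficient of g.
  umbral-translate : ∀ d g → umbral (2 ℕ.+ d) (translate (2 ℕ.+ d) g) ≡ umbral (2 ℕ.+ d) g + g 1
  umbral-translate d g = begin
    umbral D (translate D g)                                   ≡⟨ Σ<-cong D (λ k _ → *-distribʳ-Σ< D (bernoulli k) _) ⟩
    Σ< D (λ k → Σ< D (λ m → ℕ→ℚ (m C k) * g m * bernoulli k))  ≡⟨ Σ<-comm D D _ ⟩
    Σ< D (λ m → Σ< D (λ k → ℕ→ℚ (m C k) * g m * bernoulli k))  ≡⟨ Σ<-cong D (λ m m<D → column m m<D) ⟩
    Σ< D (λ m → g m * bernoulli m + g m * E m)                 ≡⟨ Σ<-distrib-+ D _ _ ⟩
    umbral D g + Σ< D (λ m → g m * E m)                        ≡⟨ cong (umbral D g +_) Σ<-g*E≡g1 ⟩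
    umbral D g + g 1                                           ∎
    where
    open ≡-Reasoning
    D = 2 ℕ.+ d
    E : ℕ → ℚ
    E m = Σ< m (λ k → ℕ→ℚ (m C k) * bernoulli k)
    column : ∀ m → m < D → Σ< D (λ k → ℕ→ℚ (m C k) * g m * bernoulli k) ≡ g m * bernoulli m + g m * E m
    column m m<D = begin
      Σ< D (λ k → ℕ→ℚ (m C k) * g m * bernoulli k)
        ≡⟨ Σ<-cong D (λ k _ → solve 3 (λ c x b → c :* x :* b := x :* (c :* b)) refl (ℕ→ℚ (m C k)) (g m) (bernoulli k)) ⟩
      Σ< D (λ k → g m * (ℕ→ℚ (m C k) * bernoulli k))
        ≡⟨ sym (*-distribˡ-Σ< D (g m) _) ⟩
      g m * Σ< D (λ k → ℕ→ℚ (m C k) * bernoulli k)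
        ≡⟨ cong (g m *_) (Σ<-vanishing-tail D _ m<D mCk≡0) ⟩
      g m * (E m + ℕ→ℚ (m C m) * bernoulli m)
        ≡⟨ cong (λ c → g m * (E m + ℕ→ℚ c * bernoulli m)) (nCn≡1 m) ⟩
      g m * (E m + 1ℚ * bernoulli m)
        ≡⟨ solve 3 (λ x e b → x :* (e :+ con 1ℚ :* b) := x :* b :+ x :* e) refl (g m) (E m) (bernoulli m) ⟩
      g m * bernoulli m + g m * E m
        ∎
      where
      mCk≡0 : ∀ k → suc m ≤ k → ℕ→ℚ (m C k) * bernoulli k ≡ 0ℚ
      mCk≡0 k m<k = trans (cong (λ c → ℕ→ℚ c * bernoulli k) (k>n⇒nCk≡0 m<k)) (*-zeroˡ (bernoulli k))
    Σ<-g*E≡g1 : Σ< D (λ m → g m * E m) ≡ g 1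
    Σ<-g*E≡g1 = trans (Σ<-vanishing-tail D (λ m → g m * E m) (s≤s (s≤s z≤n)) g*E-vanish)
      (trans (cong (λ e → 0ℚ + g 0 * 0ℚ + g 1 * e) (Σ₀-[1+n]Cj*Bj≡δ₀n 0))
        (solve 2 (λ a b → con 0ℚ :+ a :* con 0ℚ :+ b :* con 1ℚ := b) refl (g 0) (g 1)))
      where
      g*E-vanish : ∀ m → 2 ≤ m → g m * E m ≡ 0ℚ
      g*E-vanish (suc zero)    (s≤s ())
      g*E-vanish (suc (suc m)) _ = trans (cong (g (2 ℕ.+ m) *_) (Σ₀-[1+n]Cj*Bj≡δ₀n (suc m))) (*-zeroʳ (g (2 ℕ.+ m)))

  -- (x + 1)_{j+1} = (x + 1) (x)_j
  translate-falling : ∀ j k → translate (2 ℕ.+ j) (s₁ (suc j)) k ≡ s₁ j k + mulX (s₁ j) k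
  translate-falling zero    zero          = refl
  translate-falling zero    (suc zero)    = refl
  translate-falling zero    (suc (suc k)) = refl
  translate-falling (suc j) k = begin
    translate (suc d) (s₁ (2 ℕ.+ j)) k
      ≡⟨ translate-cong (suc d) k (s₁-suc (suc j)) ⟩
    translate (suc d) (λ m → mulX f m - c * f m) k
      ≡⟨ translate-linear (suc d) (mulX f) c f k ⟩
    translate (suc d) (mulX f) k - c * translate (suc d) f k
      ≡⟨ cong₂ (λ u v → u - c * v) (translate-mulX d f k) (translate-suc-vanish d f k (s₁-vanish (suc j) d (ℕ.n<1+n (suc j)))) ⟩
    (translate d f k + mulX (translate d f) k) - c * translate d f k
      ≡⟨ cong₂ (λ u v → (u + v) - c * u) (translate-falling j k) (mulX-translate k) ⟩
    (g k + x k + (x k + mulX x k)) - c * (g k + x k)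
      ≡⟨ cong (λ c → (g k + x k + (x k + mulX x k)) - c * (g k + x k)) (ℕ→ℚ-homo-+ 1 j) ⟩
    (g k + x k + (x k + mulX x k)) - (1ℚ + ℕ→ℚ j) * (g k + x k)
      ≡⟨ solve 4 (λ f x xx j → (f :+ x :+ (x :+ xx)) :- (con 1ℚ :+ j) :* (f :+ x) := (x :- j :* f) :+ (xx :- j :* x))
                 refl (g k) (x k) (mulX x k) (ℕ→ℚ j) ⟩
    (x k - ℕ→ℚ j * g k) + (mulX x k - ℕ→ℚ j * x k)
      ≡⟨ cong₂ _+_ (sym (s₁-suc j k)) (sym (mulX-s₁-suc k)) ⟩
    f k + mulX f k
      ∎
    where
    open ≡-Reasoning
    d = 2 ℕ.+ j
    f = s₁ (suc j)
    g = s₁ j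
    x = mulX g
    c = ℕ→ℚ (suc j)
    mulX-translate : ∀ k → mulX (translate d f) k ≡ x k + mulX x k
    mulX-translate zero    = refl
    mulX-translate (suc k) = translate-falling j k
    mulX-s₁-suc : ∀ k → mulX f k ≡ mulX x k - ℕ→ℚ j * x k
    mulX-s₁-suc zero    = solve 1 (λ j → con 0ℚ := con 0ℚ :- j :* con 0ℚ) refl (ℕ→ℚ j)
    mulX-s₁-suc (suc k) = s₁-suc j k

  -- Integrate (x + 1)_{j+1} - (x)_{j+1} = (j + 1) (x)_j using umbral-translate.
  [1+j]*umbral-falling : ∀ j → ℕ→ℚ (suc j) * umbral (2 ℕ.+ j) (s₁ j) ≡ sgn j * ℕ→ℚ (j !)
  [1+j]*umbral-falling j = begin
    ℕ→ℚ (suc j) * a                  ≡⟨ cong (_* a) (ℕ→ℚ-homo-+ 1 j) ⟩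
    (1ℚ + ℕ→ℚ j) * a
      ≡⟨ solve 3 (λ a b j → (con 1ℚ :+ j) :* a := (a :+ b) :- (b :- j :* a)) refl a b (ℕ→ℚ j) ⟩
    (a + b) - (b - ℕ→ℚ j * a)        ≡⟨ cong₂ _-_ a+b≡ b-ja≡ ⟩
    (umbral D f + f 1) - umbral D f  ≡⟨ solve 2 (λ x y → x :+ y :- x := y) refl (umbral D f) (f 1) ⟩
    f 1                              ≡⟨ s₁-suc-one j ⟩
    sgn j * ℕ→ℚ (j !)                ∎
    where
    open ≡-Reasoning
    D = 2 ℕ.+ j
    f = s₁ (suc j)
    a = umbral D (s₁ j)
    b = umbral D (mulX (s₁ j))
    a+b≡ : a + b ≡ umbral D f + f 1
    a+b≡ = trans (sym (umbral-+ D (s₁ j) (mulX (s₁ j))))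
      (trans (umbral-cong D (λ m → sym (translate-falling j m))) (umbral-translate j f))
    b-ja≡ : b - ℕ→ℚ j * a ≡ umbral D f
    b-ja≡ = trans (sym (umbral-linear D (mulX (s₁ j)) (ℕ→ℚ j) (s₁ j))) (umbral-cong D (λ m → sym (s₁-suc j m)))

  Σ₀-S₁jk*Bk≡sgn*j!/[1+j] : ∀ n j → j ≤ n → Σ₀ n (λ k → s₁ j k * bernoulli k) ≡ sgn j * ℕ→ℚ (j !) * recipSuc j
  Σ₀-S₁jk*Bk≡sgn*j!/[1+j] n j j≤n = begin
    Σ₀ n (λ k → s₁ j k * bernoulli k)        ≡⟨ Σ<-vanishing-tail (suc n) _ (s≤s j≤n) vanish ⟩
    Σ< (suc j) (λ k → s₁ j k * bernoulli k)  ≡⟨ Σ<-vanishing-tail (2 ℕ.+ j) _ (ℕ.n≤1+n (suc j)) vanish ⟨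
    umbral (2 ℕ.+ j) (s₁ j)                  ≡⟨ [1+n]*q≡r⇒q≡r/[1+n] j ([1+j]*umbral-falling j) ⟩
    sgn j * ℕ→ℚ (j !) * recipSuc j           ∎
    where
    open ≡-Reasoning
    vanish : ∀ k → suc j ≤ k → s₁ j k * bernoulli k ≡ 0ℚ
    vanish k j<k = trans (cong (_* bernoulli k) (s₁-vanish j k j<k)) (*-zeroˡ (bernoulli k))

  Σ₀-Bk*Σ₀-nCj*S₁jk/j!≡1/[1+n] : ∀ n →
    Σ₀ n (λ k → bernoulli k * Σ₀ n (λ j → ℕ→ℚ (n C j) * s₁ j k * inv! j)) ≡ recipSuc n
  Σ₀-Bk*Σ₀-nCj*S₁jk/j!≡1/[1+n] n = begin
    Σ₀ n (λ k → bernoulli k * Σ₀ n (λ j → c j * s₁ j k * inv! j))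
      ≡⟨ Σ<-cong (suc n) (λ k _ → *-distribˡ-Σ< (suc n) (bernoulli k) _) ⟩
    Σ₀ n (λ k → Σ₀ n (λ j → bernoulli k * (c j * s₁ j k * inv! j)))
      ≡⟨ Σ<-comm (suc n) (suc n) _ ⟩
    Σ₀ n (λ j → Σ₀ n (λ k → bernoulli k * (c j * s₁ j k * inv! j)))
      ≡⟨ Σ<-cong (suc n) (λ j _ → factor j) ⟩
    Σ₀ n (λ j → (c j * inv! j) * Σ₀ n (λ k → s₁ j k * bernoulli k))
      ≡⟨ Σ<-cong (suc n) (λ j j<1+n → cong ((c j * inv! j) *_) (Σ₀-S₁jk*Bk≡sgn*j!/[1+j] n j (ℕ.≤-pred j<1+n))) ⟩
    Σ₀ n (λ j → (c j * inv! j) * (sgn j * ℕ→ℚ (j !) * recipSuc j))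
      ≡⟨ Σ<-cong (suc n) (λ j _ → cancel j) ⟩
    Σ₀ n (λ j → sgn j * recipSuc j * c j)
      ≡⟨ Σ₀-sgn/[1+k]*nCk≡1/[1+n] n ⟩
    recipSuc n
      ∎
    where
    open ≡-Reasoning
    c = λ j → ℕ→ℚ (n C j)
    factor : ∀ j → Σ₀ n (λ k → bernoulli k * (c j * s₁ j k * inv! j)) ≡ (c j * inv! j) * Σ₀ n (λ k → s₁ j k * bernoulli k)
    factor j = trans
      (Σ<-cong (suc n) (λ k _ → solve 4 (λ b c s i → b :* (c :* s :* i) := (c :* i) :* (s :* b)) refl (bernoulli k) (c j) (s₁ j k) (inv! j)))
      (sym (*-distribˡ-Σ< (suc n) (c j * inv! j) _))
    cancel : ∀ j → (c j * inv! j) * (sgn j * ℕ→ℚ (j !) * recipSuc j) ≡ sgn j * recipSuc j * c j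
    cancel j = trans
      (solve 5 (λ c i g f r → (c :* i) :* (g :* f :* r) := g :* r :* c :* (i :* f)) refl (c j) (inv! j) (sgn j) (ℕ→ℚ (j !)) (recipSuc j))
      (trans (cong (sgn j * recipSuc j * c j *_) (inv!*!≡1 j)) (*-identityʳ _))

module PAdic where
  open Casts
  open import Data.Nat
  open import Data.Nat.Properties
  open import Data.Nat.Divisibility
  open import Data.Nat.Primality
  open import Data.Nat.Induction using (<-rec)
  open import Data.Integer as ℤ using (+_)
  import Data.Integer.Properties as ℤ
  open import Data.Rational as ℚ using (↥_; ↧_) renaming (_*_ to _*ℚ_; _-_ to _-ℚ_)
  open import Data.Product using (∃; _,_)
  open import Data.Sum using (inj₁; inj₂)
  open import Data.Empty using (⊥-elim)
  open import Relation.Nullary using (¬_; yes; no)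
  open import Relation.Binary.PropositionalEquality

  ^-monoʳ-∣ : ∀ p {a b} → a ≤ b → p ^ a ∣ p ^ b
  ^-monoʳ-∣ p {a} {b} a≤b = divides (p ^ (b ∸ a))
    (trans (cong (p ^_) (sym (m+[n∸m]≡n a≤b))) (trans (^-distribˡ-+-* p a (b ∸ a)) (*-comm (p ^ a) _)))

  module _ {p : ℕ} (pp : Prime p) where
    private instance
      p≢0 : NonZero p
      p≢0 = prime⇒nonZero pp

    p^k∣x*d∧p∤d⇒p^k∣x : ∀ {d} → ¬ p ∣ d → ∀ k x → p ^ k ∣ x * d → p ^ k ∣ x
    p^k∣x*d∧p∤d⇒p^k∣x p∤d zero    x _ = 1∣ x
    p^k∣x*d∧p∤d⇒p^k∣x {d} p∤d (suc k) x p^[1+k]∣x*d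
      with euclidsLemma x d pp (∣-trans (m∣m*n (p ^ k)) p^[1+k]∣x*d)
    ... | inj₂ p∣d              = ⊥-elim (p∤d p∣d)
    ... | inj₁ (divides y refl) = subst (p * p ^ k ∣_) (*-comm p y) (*-monoʳ-∣ p p^k∣y)
      where
      p^k∣y : p ^ k ∣ y
      p^k∣y = p^k∣x*d∧p∤d⇒p^k∣x p∤d k y (*-cancelˡ-∣ p
        (subst (p * p ^ k ∣_) (trans (cong (_* d) (*-comm y p)) (*-assoc p y d)) p^[1+k]∣x*d))

    -- The p-adic valuation of 1 + d is at most d.
    p^[e+1+d]∣x*[1+d]⇒p^e∣x : ∀ e d x → p ^ (e + suc d) ∣ x * suc d → p ^ e ∣ x
    p^[e+1+d]∣x*[1+d]⇒p^e∣x e d x = <-rec (λ d → p ^ (e + suc d) ∣ x * suc d → p ^ e ∣ x) step d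
      where
      step : ∀ d → (∀ {d′} → d′ < d → p ^ (e + suc d′) ∣ x * suc d′ → p ^ e ∣ x) →
             p ^ (e + suc d) ∣ x * suc d → p ^ e ∣ x
      step d rec h with p ∣? suc d
      ... | no p∤1+d = ∣-trans (^-monoʳ-∣ p (m≤m+n e (suc d))) (p^k∣x*d∧p∤d⇒p^k∣x p∤1+d (e + suc d) x h)
      ... | yes (divides (suc q) 1+d≡[1+q]*p) = rec q<d (*-cancelʳ-∣ p p^[e+1+q]*p∣x*[1+q]*p)
        where
        1+q<1+d : suc q < suc d
        1+q<1+d = subst (suc q <_) (sym 1+d≡[1+q]*p) (m<m*n (suc q) p (nonTrivial⇒n>1 p {{prime⇒nonTrivial pp}}))
        q<d : q < d
        q<d = ≤-pred 1+q<1+d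
        p^[e+1+q]*p∣x*[1+q]*p : p ^ (e + suc q) * p ∣ x * suc q * p
        p^[e+1+q]*p∣x*[1+q]*p = subst₂ _∣_ (*-comm p (p ^ (e + suc q)))
          (trans (cong (x *_) 1+d≡[1+q]*p) (sym (*-assoc x (suc q) p)))
          (∣-trans (^-monoʳ-∣ p (subst (_≤ e + suc d) (+-suc e (suc q)) (+-monoʳ-≤ e 1+q<1+d))) h)

    padicLim-from-multiples : ∀ d a L → (∀ N → ∃ λ s → (a N -ℚ L) *ℚ ℕ→ℚ (suc d) ≡ ℕ→ℚ (p ^ N * s)) →
                              PadicLim p a L
    padicLim-from-multiples d a L multiple e = e + suc d , λ N e+1+d≤N → bound N e+1+d≤N (multiple N)
      where
      bound : ∀ N → e + suc d ≤ N → ∃ (λ s → (a N -ℚ L) *ℚ ℕ→ℚ (suc d) ≡ ℕ→ℚ (p ^ N * s)) →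
              (p ^ e) ∣ℚ (a N -ℚ L)
      bound N e+1+d≤N (s , eq) = p^[e+1+d]∣x*[1+d]⇒p^e∣x e d ℤ.∣ ↥ q ∣
        (∣-trans (^-monoʳ-∣ p e+1+d≤N) (divides (s * ℤ.∣ ↧ q ∣) ∣↥q∣*[1+d]≡p^N*s*∣↧q∣))
        where
        q = a N -ℚ L
        ∣↥q∣*[1+d]≡p^N*s*∣↧q∣ : ℤ.∣ ↥ q ∣ * suc d ≡ s * ℤ.∣ ↧ q ∣ * p ^ N
        ∣↥q∣*[1+d]≡p^N*s*∣↧q∣ = begin
          ℤ.∣ ↥ q ∣ * suc d              ≡⟨ sym (ℤ.abs-* (↥ q) (+ suc d)) ⟩
          ℤ.∣ ↥ q ℤ.* + suc d ∣          ≡⟨ cong ℤ.∣_∣ (q*n≡z⇒↥q*n≡z*↧q q (suc d) (+ (p ^ N * s)) eq) ⟩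
          ℤ.∣ + (p ^ N * s) ℤ.* ↧ q ∣    ≡⟨ ℤ.abs-* (+ (p ^ N * s)) (↧ q) ⟩
          p ^ N * s * ℤ.∣ ↧ q ∣          ≡⟨ trans (*-assoc (p ^ N) s _) (*-comm (p ^ N) _) ⟩
          s * ℤ.∣ ↧ q ∣ * p ^ N          ∎
          where open ≡-Reasoning

module Volkenborn where
  open Casts
  open Binomial
  open PAdic
  open import Data.Nat as ℕ using (ℕ; zero; suc; _!; _^_)
  import Data.Nat.Properties as ℕ
  open import Data.Nat.Combinatorics using (_C_)
  open import Data.Nat.Primality using (Prime; prime⇒nonZero)
  open import Data.Integer using (+_)
  open import Data.Rational using (1ℚ; _+_; _*_; _-_; _/_)
  open import Data.Rational.Properties
  open import Data.Product using (∃; _,_)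
  open import Relation.Binary.PropositionalEquality
  open import Data.Rational.Solver
  open +-*-Solver

  [1+n]*Σ<[x+n]Cn≡M*[M+n]Cn : ∀ n M →
    ℕ→ℚ (suc n) * Σ< M (λ x → ℕ→ℚ ((x ℕ.+ n) C n)) ≡ ℕ→ℚ (M ℕ.* ((M ℕ.+ n) C n))
  [1+n]*Σ<[x+n]Cn≡M*[M+n]Cn n zero    = *-zeroʳ (ℕ→ℚ (suc n))
  [1+n]*Σ<[x+n]Cn≡M*[M+n]Cn n (suc M) = begin
    ℕ→ℚ (suc n) * (Σ< M f + ℕ→ℚ c)
      ≡⟨ *-distribˡ-+ (ℕ→ℚ (suc n)) _ _ ⟩
    ℕ→ℚ (suc n) * Σ< M f + ℕ→ℚ (suc n) * ℕ→ℚ c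
      ≡⟨ cong₂ _+_ ([1+n]*Σ<[x+n]Cn≡M*[M+n]Cn n M) (sym (ℕ→ℚ-homo-* (suc n) c)) ⟩
    ℕ→ℚ (M ℕ.* c) + ℕ→ℚ (suc n ℕ.* c)
      ≡⟨ sym (ℕ→ℚ-homo-+ (M ℕ.* c) _) ⟩
    ℕ→ℚ (M ℕ.* c ℕ.+ suc n ℕ.* c)
      ≡⟨ cong ℕ→ℚ M*c+[1+n]*c≡[1+M]*c′ ⟩
    ℕ→ℚ (suc M ℕ.* ((suc M ℕ.+ n) C n))
      ∎
    where
    open ≡-Reasoning
    f = λ x → ℕ→ℚ ((x ℕ.+ n) C n)
    c = (M ℕ.+ n) C n
    M*c+[1+n]*c≡[1+M]*c′ : M ℕ.* c ℕ.+ suc n ℕ.* c ≡ suc M ℕ.* ((suc M ℕ.+ n) C n)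
    M*c+[1+n]*c≡[1+M]*c′ = trans (sym (ℕ.*-distribʳ-+ c M (suc n)))
      (trans (cong (ℕ._* c) (ℕ.+-suc M n)) (sym ([1+m]*[1+m+n]Cn≡[1+m+n]*[m+n]Cn M n)))

  Σ<[x+n]Cn/M-1/[1+n]≡M*s/[1+n]! : ∀ n M .{{_ : ℕ.NonZero M}} s → n ! ℕ.* ((M ℕ.+ n) C n) ≡ n ! ℕ.+ M ℕ.* s →
    (Σ< M (λ x → ℕ→ℚ ((x ℕ.+ n) C n)) * ((+ 1) / M) - recipSuc n) * ℕ→ℚ (suc n !) ≡ ℕ→ℚ (M ℕ.* s)
  Σ<[x+n]Cn/M-1/[1+n]≡M*s/[1+n]! n M s n!*c≡n!+M*s = begin
    (S * rM - rN) * ℕ→ℚ (suc n ℕ.* n !)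
      ≡⟨ cong ((S * rM - rN) *_) (ℕ→ℚ-homo-* (suc n) (n !)) ⟩
    (S * rM - rN) * (N * F)
      ≡⟨ solve 5 (λ S rM rN N F → (S :* rM :- rN) :* (N :* F) := rM :* (N :* S) :* F :- (rN :* N) :* F) refl S rM rN N F ⟩
    rM * (N * S) * F - (rN * N) * F
      ≡⟨ cong₂ (λ u v → rM * u * F - v * F) ([1+n]*Σ<[x+n]Cn≡M*[M+n]Cn n M) (1/n*n≡1 (suc n)) ⟩
    rM * ℕ→ℚ (M ℕ.* c) * F - 1ℚ * F
      ≡⟨ cong (λ u → rM * u * F - 1ℚ * F) (ℕ→ℚ-homo-* M c) ⟩
    rM * (ℕ→ℚ M * ℕ→ℚ c) * F - 1ℚ * F
      ≡⟨ solve 4 (λ rM m c F → rM :* (m :* c) :* F :- con 1ℚ :* F := (rM :* m) :* (F :* c) :- F) refl rM (ℕ→ℚ M) (ℕ→ℚ c) F ⟩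
    (rM * ℕ→ℚ M) * (F * ℕ→ℚ c) - F
      ≡⟨ cong₂ (λ u v → u * v - F) (1/n*n≡1 M) F*c≡F+M*s ⟩
    1ℚ * (F + ℕ→ℚ (M ℕ.* s)) - F
      ≡⟨ solve 2 (λ F x → con 1ℚ :* (F :+ x) :- F := x) refl F (ℕ→ℚ (M ℕ.* s)) ⟩
    ℕ→ℚ (M ℕ.* s)
      ∎
    where
    open ≡-Reasoning
    S = Σ< M (λ x → ℕ→ℚ ((x ℕ.+ n) C n))
    rM = (+ 1) / M
    rN = recipSuc n
    N = ℕ→ℚ (suc n)
    F = ℕ→ℚ (n !)
    c = (M ℕ.+ n) C n
    F*c≡F+M*s : F * ℕ→ℚ c ≡ F + ℕ→ℚ (M ℕ.* s)
    F*c≡F+M*s = trans (sym (ℕ→ℚ-homo-* (n !) c)) (trans (cong ℕ→ℚ n!*c≡n!+M*s) (ℕ→ℚ-homo-+ (n !) (M ℕ.* s)))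

  ∫[x+n]Cn≡1/[1+n] : ∀ p (pp : Prime p) n → VolkenbornIntegral p pp (λ x → ℕ→ℚ ((x ℕ.+ n) C n)) (recipSuc n)
  ∫[x+n]Cn≡1/[1+n] p pp n = padicLim-from-multiples pp d (volkenbornPartial p pp f) (recipSuc n) multiple
    where
    instance _ = prime⇒nonZero pp
    f = λ x → ℕ→ℚ ((x ℕ.+ n) C n)
    d = ℕ.pred (suc n !)
    1+d≡[1+n]! : suc d ≡ suc n !
    1+d≡[1+n]! = ℕ.suc-pred (suc n !) {{suc n ℕ.!≢0}}
    multiple : ∀ N → ∃ λ s → (volkenbornPartial p pp f N - recipSuc n) * ℕ→ℚ (suc d) ≡ ℕ→ℚ (p ^ N ℕ.* s)
    multiple N with n!*[M+n]Cn≡n!-mod-M n (p ^ N)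
    ... | s , eq = s , subst (λ m → (volkenbornPartial p pp f N - recipSuc n) * ℕ→ℚ m ≡ ℕ→ℚ (p ^ N ℕ.* s))
                     (sym 1+d≡[1+n]!) (Σ<[x+n]Cn/M-1/[1+n]≡M*s/[1+n]! n (p ^ N) {{ℕ.m^n≢0 p N}} s eq)

open Differences using (Σ₀-sgn/[1+k]*Δᵏ[y+n]Cn≡1/[1+n])
open Umbral using (Σ₀-Bk*Σ₀-nCj*S₁jk/j!≡1/[1+n])
open Volkenborn using (∫[x+n]Cn≡1/[1+n])
open import Data.Nat using (ℕ; _+_; _∸_)
open import Data.Nat.Combinatorics using (_C_)
open import Data.Nat.Primality using (Prime)
open import Data.Rational using (_*_)
open import Data.Product using (_×_; _,_)
open import Relation.Binary.PropositionalEquality using (subst; sym)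

mainTheorem14 : (p : ℕ) (pp : Prime p) (n : ℕ) →
    VolkenbornIntegral p pp (λ x → ℕ→ℚ ((x + n) C n))
      (Σ₀ n (λ k → sgn k * recipSuc k * Σ₀ k (λ j → sgn j * ℕ→ℚ (k C j) * ℕ→ℚ ((k ∸ j + n) C n))))
    ×
    VolkenbornIntegral p pp (λ x → ℕ→ℚ ((x + n) C n))
      (Σ₀ n (λ k → bernoulli k * Σ₀ n (λ j → ℕ→ℚ (n C j) * ℤ→ℚ (S₁ j k) * inv! j)))
mainTheorem14 p pp n = subst (VolkenbornIntegral p pp _) (sym (Σ₀-sgn/[1+k]*Δᵏ[y+n]Cn≡1/[1+n] n)) integral
                     , subst (VolkenbornIntegral p pp _) (sym (Σ₀-Bk*Σ₀-nCj*S₁jk/j!≡1/[1+n] n)) integral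
  where
  integral : VolkenbornIntegral p pp (λ x → ℕ→ℚ ((x + n) C n)) (recipSuc n)
  integral = ∫[x+n]Cn≡1/[1+n] p pp n
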